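{- Let $G$ be a split graph whose vertex set is partitioned into a maximum clique $K$ of size $k=\chi(G)$ and an independent set $S$ of size $s$. Then every color class has odd size in every proper $k$-vertex coloring of $G$ if and only if every vertex of $S$ has degree $k-1$ and, for every vertex $x\in K$, the degree of $x$ has parity opposite to that of $k+s$.
   Context: A split graph is a graph whose vertex set can be partitioned into a clique and an independent set. $\chi(G)$ is the chromatic number. -}

module Defs where

open import Data.Nat using (ℕ; zero; suc; _+_; _%_; _<_)
open import Data.Bool using (Bool; true; false; if_then_else_)
open import Data.Fin using (Fin; zero; suc)
open import Data.Fin.Properties using () renaming (_≟_ to _≟ᶠ_)
open import Relation.Nullary using (¬_; does)
open import Relation.Binary.PropositionalEquality using (_≡_; _≢_)
open import Data.Product using (Σ; ∃; _×_)

count : {n : ℕ} → (Fin n → Bool) → ℕ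
count {zero}  P = 0
count {suc n} P = (if P zero then 1 else 0) + count (λ i → P (suc i))

record Graph (n : ℕ) : Set where
  field
    E     : Fin n → Fin n → Bool
    sym   : ∀ x y → E x y ≡ E y x
    loopless : ∀ x → E x x ≡ false
open Graph public

VSet : ℕ → Set
VSet n = Fin n → Bool

∣_∣ : {n : ℕ} → VSet n → ℕ
∣ A ∣ = count A

degree : {n : ℕ} → Graph n → Fin n → ℕ
degree G x = count (E G x)

IsClique : {n : ℕ} → Graph n → VSet n → Set
IsClique G A = ∀ x y → A x ≡ true → A y ≡ true → x ≢ y → E G x y ≡ true

IsIndependent : {n : ℕ} → Graph n → VSet n → Set
IsIndependent G A = ∀ x y → A x ≡ true → A y ≡ true → E G x y ≡ false

IsMaximumClique : {n : ℕ} → Graph n → VSet n → Set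
IsMaximumClique G A = IsClique G A × (∀ B → IsClique G B → ∣ B ∣ Data.Nat.≤ ∣ A ∣)

∁ : {n : ℕ} → VSet n → VSet n
∁ A x = Data.Bool.not (A x)

IsProperColoring : {n : ℕ} → Graph n → (k : ℕ) → (Fin n → Fin k) → Set
IsProperColoring G k c = ∀ x y → E G x y ≡ true → c x ≢ c y

Colorable : {n : ℕ} → Graph n → ℕ → Set
Colorable G k = Σ _ (IsProperColoring G k)

IsChromaticNumber : {n : ℕ} → Graph n → ℕ → Set
IsChromaticNumber G k = Colorable G k × (∀ j → j < k → ¬ Colorable G j)

colorClass : {n k : ℕ} → (Fin n → Fin k) → Fin k → VSet n
colorClass c i v = does (c v ≟ᶠ i)

Odd : ℕ → Set
Odd m = m % 2 ≡ 1

module Submission where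

-- In a proper ∣K∣-colouring c the clique K meets every colour exactly once, and every v ∉ K has a
-- non-neighbour in K (otherwise K ∪ {v} is a larger clique); v's colour is that of one of these.
-- If some v ∉ K had two non-neighbours x₁, x₂ ∈ K, recolouring v with c x₁, respectively c x₂,
-- gives two proper colourings whose classes of colour c x₁ differ by exactly the vertex v, so
-- they cannot both be odd. Hence all classes odd forces every v ∉ K to have exactly one
-- non-neighbour in K, i.e. degree ∣K∣ − 1. Under that condition the class of c x for x ∈ K is x
-- together with the non-neighbours of x outside K, so its size plus deg x is ∣K∣ + ∣∁K∣, which
-- turns oddness of the class into the parity condition on deg x.

open import Defs hiding (sym)
open import Algebra.Properties.CommutativeMonoid.Sum as Sum using ()
open import Data.Bool using (true; false; _∧_; _∨_; not; if_then_else_)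
open import Data.Bool.Properties using (∧-zeroʳ; ∧-identityʳ; ∨-identityʳ; ∧-comm; not-involutive)
open import Data.Empty using (⊥-elim)
open import Data.Fin using (Fin; zero; suc; punchIn)
open import Data.Vec.Functional using (removeAt)
open import Data.Fin.Properties using (suc-injective) renaming (_≟_ to _≟ᶠ_)
open import Data.Nat using (ℕ; zero; suc; _+_; _∸_; _%_; _≤_; z≤n; s≤s; s≤s⁻¹)
open import Data.Nat.Properties
  using (+-0-commutativeMonoid; +-suc; +-identityʳ; +-cancelˡ-≡;
         m+n≡0⇒n≡0; m<n⇒n≢0; n≢0⇒n>0; +-mono-≤; 1+n≰n; module ≤-Reasoning; ≮⇒≥; <⇒≱; n≤1⇒n≡0∨n≡1)
open import Data.Nat.Tactic.RingSolver using (solve-∀)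
open import Data.Product using (_×_; _,_; ∃; ∃₂)
open import Data.Sum using (_⊎_; inj₁; inj₂)
open import Function using (_∘_; case_of_)
open import Function.Bundles using (_⇔_; mk⇔; Equivalence)
open import Relation.Binary.PropositionalEquality
  using (_≡_; _≢_; refl; sym; trans; cong; cong₂; subst; module ≡-Reasoning)
open import Relation.Nullary using (¬_; yes; no; does)
open import Relation.Nullary.Decidable using (dec-true; dec-false)

open Sum +-0-commutativeMonoid using (sum; sum-remove; ∑-distrib-+; sum-replicate-zero)

≟ᶠ-true⇒≡ : ∀ {m} {x y : Fin m} → does (x ≟ᶠ y) ≡ true → x ≡ y
≟ᶠ-true⇒≡ {x = x} {y} eq with x ≟ᶠ y
... | yes x≡y = x≡y

not-true⇒false : ∀ {b} → not b ≡ true → b ≡ false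
not-true⇒false {b} eq = trans (sym (not-involutive b)) (cong not eq)

not-false⇒true : ∀ {b} → not b ≡ false → b ≡ true
not-false⇒true {b} eq = trans (sym (not-involutive b)) (cong not eq)

∧-true : ∀ {a b} → a ∧ b ≡ true → a ≡ true × b ≡ true
∧-true {true} {true} _ = refl , refl

count-cong : ∀ {n} {P Q : VSet n} → (∀ x → P x ≡ Q x) → count P ≡ count Q
count-cong {zero}  _   = refl
count-cong {suc n} P≗Q rewrite P≗Q zero = cong (_ +_) (count-cong (P≗Q ∘ suc))

count-none : ∀ {n} {P : VSet n} → (∀ x → P x ≡ false) → count P ≡ 0
count-none {zero}  _     = refl
count-none {suc n} P≗∅ rewrite P≗∅ zero = count-none (P≗∅ ∘ suc)

count-split : ∀ {n} (P Q : VSet n) →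
  count P ≡ count (λ x → P x ∧ Q x) + count (λ x → P x ∧ not (Q x))
count-split {zero}  P Q = refl
count-split {suc n} P Q with P zero | Q zero | count-split (P ∘ suc) (Q ∘ suc)
... | true  | true  | ih = cong suc ih
... | true  | false | ih = trans (cong suc ih) (sym (+-suc _ _))
... | false | _     | ih = ih

count≡0⇒false : ∀ {n} {P : VSet n} → count P ≡ 0 → ∀ x → P x ≡ false
count≡0⇒false {suc n} {P} #P≡0 zero with P zero
... | false = refl
... | true  = case #P≡0 of λ ()
count≡0⇒false {suc n} {P} #P≡0 (suc x) = count≡0⇒false (m+n≡0⇒n≡0 (if P zero then 1 else 0) #P≡0) x

true⇒count≢0 : ∀ {n} (P : VSet n) {x} → P x ≡ true → count P ≢ 0
true⇒count≢0 P {x} Px #P≡0 = case trans (sym Px) (count≡0⇒false #P≡0 x) of λ ()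

count≢0⇒∃ : ∀ {n} (P : VSet n) → count P ≢ 0 → ∃ λ x → P x ≡ true
count≢0⇒∃ {zero}  P #P≢0 = ⊥-elim (#P≢0 refl)
count≢0⇒∃ {suc n} P #P≢0 with P zero in P0
... | true  = zero , P0
... | false with count≢0⇒∃ (P ∘ suc) #P≢0
...   | x , Px = suc x , Px

count-insert : ∀ {n} {P Q : VSet n} (x : Fin n) → P x ≡ true → Q x ≡ false →
  (∀ y → y ≢ x → P y ≡ Q y) → count P ≡ suc (count Q)
count-insert {suc n} {P} {Q} zero Px Qx P≗Q rewrite Px | Qx =
  cong suc (count-cong (λ y → P≗Q (suc y) λ ()))
count-insert {suc n} {P} {Q} (suc x) Px Qx P≗Q rewrite P≗Q zero (λ ()) =
  trans (cong (_ +_) (count-insert x Px Qx (λ y y≢x → P≗Q (suc y) (y≢x ∘ suc-injective))))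
        (+-suc _ _)

count-single : ∀ {n} {P : VSet n} (x : Fin n) → P x ≡ true → (∀ y → y ≢ x → P y ≡ false) → count P ≡ 1
count-single {n} x Px P≗∅ = trans (count-insert x Px refl P≗∅) (cong suc (count-none {n} λ _ → refl))

_─_ : ∀ {n} → VSet n → Fin n → VSet n
(P ─ x) y = P y ∧ not (does (y ≟ᶠ x))

─-at : ∀ {n} (P : VSet n) x → (P ─ x) x ≡ false
─-at P x = trans (cong (λ b → P x ∧ not b) (dec-true (x ≟ᶠ x) refl)) (∧-zeroʳ (P x))

─-off : ∀ {n} (P : VSet n) {x y} → y ≢ x → (P ─ x) y ≡ P y
─-off P {x} {y} y≢x = trans (cong (λ b → P y ∧ not b) (dec-false (y ≟ᶠ x) y≢x)) (∧-identityʳ (P y))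

count-remove : ∀ {n} (P : VSet n) {x} → P x ≡ true → count P ≡ suc (count (P ─ x))
count-remove P {x} Px = count-insert x Px (─-at P x) (λ y y≢x → sym (─-off P y≢x))

two-points⇒2≤count : ∀ {n} (P : VSet n) {x y} → x ≢ y → P x ≡ true → P y ≡ true → 2 ≤ count P
two-points⇒2≤count P {x} {y} x≢y Px Py = subst (2 ≤_) (sym (count-remove P Px))
  (s≤s (n≢0⇒n>0 (true⇒count≢0 (P ─ x) (trans (─-off P (x≢y ∘ sym)) Py))))

2≤count⇒two-points : ∀ {n} (P : VSet n) → 2 ≤ count P →
  ∃₂ λ x y → x ≢ y × P x ≡ true × P y ≡ true
2≤count⇒two-points P 2≤#P with count≢0⇒∃ P (m<n⇒n≢0 2≤#P)
... | x , Px with count≢0⇒∃ (P ─ x) (m<n⇒n≢0 (s≤s⁻¹ (subst (2 ≤_) (count-remove P Px) 2≤#P)))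
...   | y , P─x[y] with x ≟ᶠ y
...     | yes refl = case trans (sym P─x[y]) (─-at P x) of λ ()
...     | no  x≢y  = x , y , x≢y , Px , trans (sym (─-off P (x≢y ∘ sym))) P─x[y]

count≤1 : ∀ {n} (P : VSet n) → (∀ x y → P x ≡ true → P y ≡ true → x ≡ y) → count P ≤ 1
count≤1 P unique = ≮⇒≥ λ 1<#P →
  let x , y , x≢y , Px , Py = 2≤count⇒two-points P 1<#P in x≢y (unique x y Px Py)

count≡1⇒unique : ∀ {n} (P : VSet n) → count P ≡ 1 → ∀ {x y} → P x ≡ true → P y ≡ true → x ≡ y
count≡1⇒unique P #P≡1 {x} {y} Px Py with x ≟ᶠ y
... | yes x≡y = x≡y
... | no  x≢y = ⊥-elim (<⇒≱ (s≤s (s≤s z≤n)) (subst (2 ≤_) #P≡1 (two-points⇒2≤count P x≢y Px Py)))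

sum≤length : ∀ {k} (f : Fin k → ℕ) → (∀ i → f i ≤ 1) → sum f ≤ k
sum≤length {zero}  f f≤1 = z≤n
sum≤length {suc k} f f≤1 = +-mono-≤ (f≤1 zero) (sum≤length (f ∘ suc) (f≤1 ∘ suc))

sum≡length⇒≢0 : ∀ {k} (f : Fin k → ℕ) → (∀ i → f i ≤ 1) → sum f ≡ k → ∀ i → f i ≢ 0
sum≡length⇒≢0 {suc k} f f≤1 Σf≡k i fi≡0 = 1+n≰n (begin
  suc k                      ≡⟨ Σf≡k ⟨
  sum f                      ≡⟨ sum-remove f ⟩
  f i + sum (removeAt f i)   ≡⟨ cong (_+ sum (removeAt f i)) fi≡0 ⟩
  sum (removeAt f i)         ≤⟨ sum≤length (removeAt f i) (f≤1 ∘ punchIn i) ⟩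
  k                          ∎)
  where open ≤-Reasoning

sum-indicator : ∀ {k} (j : Fin k) → sum (λ i → if does (j ≟ᶠ i) then 1 else 0) ≡ 1
sum-indicator {suc k} zero    = cong suc (sum-replicate-zero k)
sum-indicator {suc k} (suc j) = sum-indicator j

count-by-colour : ∀ {n k} (P : VSet n) (c : Fin n → Fin k) →
  count P ≡ sum (λ i → count (λ x → P x ∧ does (c x ≟ᶠ i)))
count-by-colour {zero}  {k} P c = sym (sum-replicate-zero k)
count-by-colour {suc n} {k} P c = begin
  count P
    ≡⟨ cong₂ _+_ head≡ (count-by-colour (P ∘ suc) (c ∘ suc)) ⟩
  sum (λ i → if P zero ∧ does (c zero ≟ᶠ i) then 1 else 0)
    + sum (λ i → count (λ x → P (suc x) ∧ does (c (suc x) ≟ᶠ i)))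
    ≡⟨ ∑-distrib-+ (λ i → if P zero ∧ does (c zero ≟ᶠ i) then 1 else 0) _ ⟨
  sum (λ i → count (λ x → P x ∧ does (c x ≟ᶠ i))) ∎
  where
  open ≡-Reasoning
  head≡ : (if P zero then 1 else 0) ≡ sum (λ i → if P zero ∧ does (c zero ≟ᶠ i) then 1 else 0)
  head≡ with P zero
  ... | true  = sym (sum-indicator (c zero))
  ... | false = sym (sum-replicate-zero k)

m%2≢[1+m]%2 : ∀ m → m % 2 ≢ suc m % 2
m%2≢[1+m]%2 zero          ()
m%2≢[1+m]%2 (suc zero)    ()
m%2≢[1+m]%2 (suc (suc m)) = m%2≢[1+m]%2 m

odd⇒¬odd-suc : ∀ m → Odd m → ¬ Odd (suc m)
odd⇒¬odd-suc m odd-m odd-1+m = m%2≢[1+m]%2 m (trans odd-m (sym odd-1+m))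

odd⇔parity-differs : ∀ a d → Odd a ⇔ d % 2 ≢ (a + d) % 2
odd⇔parity-differs zero          d = mk⇔ (λ ()) (λ d≢d → ⊥-elim (d≢d refl))
odd⇔parity-differs (suc zero)    d = mk⇔ (λ _ → m%2≢[1+m]%2 d) (λ _ → refl)
odd⇔parity-differs (suc (suc a)) d = odd⇔parity-differs a d

recolour : ∀ {n k} → (Fin n → Fin k) → Fin n → Fin k → Fin n → Fin k
recolour c v a y = if does (y ≟ᶠ v) then a else c y

recolour-at : ∀ {n k} (c : Fin n → Fin k) v a → recolour c v a v ≡ a
recolour-at c v a rewrite dec-true (v ≟ᶠ v) refl = refl

recolour-off : ∀ {n k} (c : Fin n → Fin k) {v y} a → y ≢ v → recolour c v a y ≡ c y
recolour-off c {v} {y} a y≢v rewrite dec-false (y ≟ᶠ v) y≢v = refl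

recolour-proper : ∀ {n k} (G : Graph n) {c : Fin n → Fin k} {v a} → IsProperColoring G k c →
  (∀ y → E G v y ≡ true → c y ≢ a) → IsProperColoring G k (recolour c v a)
recolour-proper G {c} {v} {a} c-proper a-free x y Exy with x ≟ᶠ v | y ≟ᶠ v
... | yes refl | yes refl = λ _ → case trans (sym Exy) (loopless G v) of λ ()
... | yes refl | no _     = λ a≡cy → a-free y Exy (sym a≡cy)
... | no _     | yes refl = a-free x (trans (Graph.sym G v x) Exy)
... | no _     | no _     = c-proper x y Exy

m≡m+n∸1⇔n≡1 : ∀ m n → n ≢ 0 → m ≡ m + n ∸ 1 ⇔ n ≡ 1
m≡m+n∸1⇔n≡1 m zero    n≢0 = ⊥-elim (n≢0 refl)
m≡m+n∸1⇔n≡1 m (suc n) _ rewrite +-suc m n = mk⇔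
  (λ m≡m+n → cong suc (+-cancelˡ-≡ m n 0 (trans (sym m≡m+n) (sym (+-identityʳ m)))))
  (λ { refl → sym (+-identityʳ m) })

module SplitGraph {n : ℕ} (G : Graph n) (K : VSet n)
  (K-clique : IsClique G K) (S-independent : IsIndependent G (∁ K)) where

  neighbour-of-S∈K : ∀ {v y} → K v ≡ false → E G v y ≡ true → K y ≡ true
  neighbour-of-S∈K {v} {y} v∉K Evy with K y in Ky
  ... | true  = refl
  ... | false = case trans (sym Evy) (S-independent v y (cong not v∉K) (cong not Ky)) of λ ()

  nonNeighbours : Fin n → ℕ
  nonNeighbours v = count (λ y → K y ∧ not (E G v y))

  degree+nonNeighbours : ∀ {v} → K v ≡ false → degree G v + nonNeighbours v ≡ ∣ K ∣
  degree+nonNeighbours {v} v∉K = begin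
    degree G v + nonNeighbours v                      ≡⟨ cong (_+ nonNeighbours v) degree≡ ⟩
    count (λ y → K y ∧ E G v y) + nonNeighbours v     ≡⟨ count-split K (E G v) ⟨
    ∣ K ∣                                             ∎
    where
    open ≡-Reasoning
    no-neighbour-in-S : ∀ y → (E G v y ∧ not (K y)) ≡ false
    no-neighbour-in-S y with E G v y in Evy
    ... | false = refl
    ... | true rewrite neighbour-of-S∈K v∉K Evy = refl
    degree≡ : degree G v ≡ count (λ y → K y ∧ E G v y)
    degree≡ = trans (count-split (E G v) K)
      (trans (cong₂ _+_ (count-cong λ y → ∧-comm (E G v y) (K y)) (count-none no-neighbour-in-S))
             (+-identityʳ _))

  degree≡∣K∣∸1⇔nonNeighbours≡1 : ∀ {v} → K v ≡ false → nonNeighbours v ≢ 0 →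
    degree G v ≡ ∣ K ∣ ∸ 1 ⇔ nonNeighbours v ≡ 1
  degree≡∣K∣∸1⇔nonNeighbours≡1 {v} v∉K ≢0 =
    subst (λ t → degree G v ≡ t ∸ 1 ⇔ nonNeighbours v ≡ 1) (degree+nonNeighbours v∉K)
      (m≡m+n∸1⇔n≡1 (degree G v) (nonNeighbours v) ≢0)

  suc[degreeInK]≡∣K∣ : ∀ {x} → K x ≡ true → suc (count (λ y → E G x y ∧ K y)) ≡ ∣ K ∣
  suc[degreeInK]≡∣K∣ {x} x∈K = sym (count-insert x x∈K (cong (_∧ K x) (loopless G x)) adjacent-in-K)
    where
    adjacent-in-K : ∀ y → y ≢ x → K y ≡ (E G x y ∧ K y)
    adjacent-in-K y y≢x with K y in Ky
    ... | true  rewrite K-clique x y x∈K Ky (y≢x ∘ sym) = refl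
    ... | false = sym (∧-zeroʳ (E G x y))

  nonNeighbours≢0 : (∀ B → IsClique G B → ∣ B ∣ ≤ ∣ K ∣) → ∀ {v} → K v ≡ false → nonNeighbours v ≢ 0
  nonNeighbours≢0 K-maximum {v} v∉K #≡0 =
    1+n≰n (subst (_≤ ∣ K ∣) ∣K+v∣≡ (K-maximum K+v K+v-clique))
    where
    K+v : VSet n
    K+v y = K y ∨ does (y ≟ᶠ v)
    v-adjacent : ∀ y → K y ≡ true → E G v y ≡ true
    v-adjacent y y∈K =
      not-false⇒true (subst (λ b → (b ∧ not (E G v y)) ≡ false) y∈K (count≡0⇒false #≡0 y))
    ∈K+v : ∀ {y} → K+v y ≡ true → K y ≡ true ⊎ y ≡ v
    ∈K+v {y} y∈K+v with K y
    ... | true  = inj₁ refl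
    ... | false = inj₂ (≟ᶠ-true⇒≡ y∈K+v)
    K+v-clique : IsClique G K+v
    K+v-clique x y x∈ y∈ x≢y with ∈K+v x∈ | ∈K+v y∈
    ... | inj₁ x∈K  | inj₁ y∈K  = K-clique x y x∈K y∈K x≢y
    ... | inj₁ x∈K  | inj₂ refl = trans (Graph.sym G x v) (v-adjacent x x∈K)
    ... | inj₂ refl | inj₁ y∈K  = v-adjacent y y∈K
    ... | inj₂ refl | inj₂ refl = ⊥-elim (x≢y refl)
    ∣K+v∣≡ : ∣ K+v ∣ ≡ suc ∣ K ∣
    ∣K+v∣≡ = count-insert v (trans (cong (_∨ does (v ≟ᶠ v)) v∉K) (dec-true (v ≟ᶠ v) refl)) v∉K
      λ y y≢v → trans (cong (K y ∨_) (dec-false (y ≟ᶠ v) y≢v)) (∨-identityʳ (K y))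

  OneNonNeighbourEach : Set
  OneNonNeighbourEach = ∀ v → K v ≡ false → nonNeighbours v ≡ 1

  module _ {c : Fin n → Fin ∣ K ∣} (c-proper : IsProperColoring G ∣ K ∣ c) where

    colour-injective-on-K : ∀ {x y} → K x ≡ true → K y ≡ true → c x ≡ c y → x ≡ y
    colour-injective-on-K {x} {y} x∈K y∈K cx≡cy with x ≟ᶠ y
    ... | yes x≡y = x≡y
    ... | no  x≢y = ⊥-elim (c-proper x y (K-clique x y x∈K y∈K x≢y) cx≡cy)

    -- ∣ K ∣ = Σᵢ ∣ K ∩ class i ∣ and by injectivity every term is at most 1, so none is 0.
    every-colour-meets-K : ∀ i → ∃ λ x → K x ≡ true × c x ≡ i
    every-colour-meets-K i with count≢0⇒∃ _ (sum≡length⇒≢0 _ at-most-once (sym (count-by-colour K c)) i)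
      where
      at-most-once : ∀ j → count (λ x → K x ∧ does (c x ≟ᶠ j)) ≤ 1
      at-most-once j = count≤1 _ λ x y x∈ y∈ →
        let x∈K , cx≡j = ∧-true {K x} x∈ ; y∈K , cy≡j = ∧-true {K y} y∈ in
        colour-injective-on-K x∈K y∈K (trans (≟ᶠ-true⇒≡ cx≡j) (sym (≟ᶠ-true⇒≡ cy≡j)))
    ... | x , x∈ with ∧-true {K x} x∈
    ...   | x∈K , cx≡i = x , x∈K , ≟ᶠ-true⇒≡ cx≡i

    module _ (one : OneNonNeighbourEach) {x : Fin n} (x∈K : K x ≡ true) where

      -- y ∉ K shares the colour of some u ∈ K, which is a non-neighbour of y, hence u = x.
      class-outside-K : ∀ y → K y ≡ false → colorClass c (c x) y ≡ not (E G x y)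
      class-outside-K y y∉K with E G x y in Exy
      ... | true  = dec-false (c y ≟ᶠ c x) λ cy≡cx → c-proper x y Exy (sym cy≡cx)
      ... | false with every-colour-meets-K (c y)
      ...   | u , u∈K , cu≡cy = dec-true (c y ≟ᶠ c x) (trans (sym cu≡cy) (cong c u≡x))
        where
        non-neighbour : ∀ {w} → K w ≡ true → E G y w ≡ false → (K w ∧ not (E G y w)) ≡ true
        non-neighbour w∈K Eyw rewrite w∈K | Eyw = refl
        Eyu : E G y u ≡ false
        Eyu with E G y u in Eyu
        ... | false = refl
        ... | true  = ⊥-elim (c-proper y u Eyu (sym cu≡cy))
        u≡x : u ≡ x
        u≡x = count≡1⇒unique _ (one y y∉K) (non-neighbour u∈K Eyu)
                (non-neighbour x∈K (trans (Graph.sym G y x) Exy))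

      class-in-K : ∀ y → y ≢ x → (colorClass c (c x) y ∧ K y) ≡ false
      class-in-K y y≢x with K y in Ky
      ... | true  = trans (∧-identityʳ _) (dec-false (c y ≟ᶠ c x) (y≢x ∘ colour-injective-on-K Ky x∈K))
      ... | false = ∧-zeroʳ _

      ∣colorClass∣+degree : ∣ colorClass c (c x) ∣ + degree G x ≡ ∣ K ∣ + ∣ ∁ K ∣
      ∣colorClass∣+degree = begin
        ∣ Cx ∣ + degree G x    ≡⟨ cong₂ _+_ ∣Cx∣≡1+A degree≡D+B ⟩
        (1 + A) + (D + B)      ≡⟨ rearrange A B D ⟩
        suc D + (B + A)        ≡⟨ cong₂ _+_ (suc[degreeInK]≡∣K∣ x∈K) (sym (count-split (∁ K) (E G x))) ⟩
        ∣ K ∣ + ∣ ∁ K ∣        ∎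
        where
        open ≡-Reasoning
        Cx : VSet n
        Cx = colorClass c (c x)
        A B D : ℕ
        A = count (λ y → not (K y) ∧ not (E G x y))
        B = count (λ y → not (K y) ∧ E G x y)
        D = count (λ y → E G x y ∧ K y)
        rearrange : ∀ a b d → (1 + a) + (d + b) ≡ suc d + (b + a)
        rearrange = solve-∀
        Cx∩K≡1 : count (λ y → Cx y ∧ K y) ≡ 1
        Cx∩K≡1 = count-single x (trans (cong (_∧ K x) (dec-true (c x ≟ᶠ c x) refl)) x∈K) class-in-K
        Cx∖K≗ : ∀ y → (Cx y ∧ not (K y)) ≡ (not (K y) ∧ not (E G x y))
        Cx∖K≗ y with K y in Ky
        ... | true  = ∧-zeroʳ (Cx y)
        ... | false = trans (∧-identityʳ (Cx y)) (class-outside-K y Ky)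

        ∣Cx∣≡1+A : ∣ Cx ∣ ≡ 1 + A
        ∣Cx∣≡1+A = trans (count-split Cx K) (cong₂ _+_ Cx∩K≡1 (count-cong Cx∖K≗))
        degree≡D+B : degree G x ≡ D + B
        degree≡D+B = trans (count-split (E G x) K) (cong (D +_) (count-cong λ y → ∧-comm (E G x y) (not (K y))))

      odd-class⇔parity : Odd ∣ colorClass c (c x) ∣ ⇔ degree G x % 2 ≢ (∣ K ∣ + ∣ ∁ K ∣) % 2
      odd-class⇔parity =
        subst (λ t → Odd ∣ colorClass c (c x) ∣ ⇔ degree G x % 2 ≢ t % 2) ∣colorClass∣+degree
        (odd⇔parity-differs ∣ colorClass c (c x) ∣ (degree G x))

  DegreeConditions : Set
  DegreeConditions = (∀ v → K v ≡ false → degree G v ≡ ∣ K ∣ ∸ 1) ×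
                     (∀ x → K x ≡ true → degree G x % 2 ≢ (∣ K ∣ + ∣ ∁ K ∣) % 2)

  AllClassesOdd : Set
  AllClassesOdd = (c : Fin n → Fin ∣ K ∣) → IsProperColoring G ∣ K ∣ c → ∀ i → Odd ∣ colorClass c i ∣

  allOdd⇒nonNeighbours≱2 : AllClassesOdd → ∀ {c} → IsProperColoring G ∣ K ∣ c →
    ∀ {v} → K v ≡ false → ¬ 2 ≤ nonNeighbours v
  allOdd⇒nonNeighbours≱2 odd {c} c-proper {v} v∉K 2≤#
    with 2≤count⇒two-points _ 2≤#
  ... | x₁ , x₂ , x₁≢x₂ , x₁∈ , x₂∈ with ∧-true {K x₁} x₁∈ | ∧-true {K x₂} x₂∈
  ... | x₁∈K , _ | x₂∈K , _ =
    odd⇒¬odd-suc ∣ colorClass c₂ (c x₁) ∣ (odd c₂ (recoloured-proper x₂∈) (c x₁))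
      (subst Odd ∣class₁∣≡suc∣class₂∣ (odd c₁ (recoloured-proper x₁∈) (c x₁)))
    where
    recoloured-proper : ∀ {u} → (K u ∧ not (E G v u)) ≡ true → IsProperColoring G ∣ K ∣ (recolour c v (c u))
    recoloured-proper {u} u∈ with ∧-true {K u} u∈
    ... | u∈K , ¬Evu = recolour-proper G c-proper λ y Evy →
      c-proper y u (K-clique y u (neighbour-of-S∈K v∉K Evy) u∈K
        λ { refl → case trans (sym Evy) (not-true⇒false ¬Evu) of λ () })
    c₁ c₂ : Fin n → Fin ∣ K ∣
    c₁ = recolour c v (c x₁)
    c₂ = recolour c v (c x₂)
    ∣class₁∣≡suc∣class₂∣ : ∣ colorClass c₁ (c x₁) ∣ ≡ suc ∣ colorClass c₂ (c x₁) ∣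
    ∣class₁∣≡suc∣class₂∣ = count-insert v
      (trans (cong (λ z → does (z ≟ᶠ c x₁)) (recolour-at c v (c x₁))) (dec-true (c x₁ ≟ᶠ c x₁) refl))
      (trans (cong (λ z → does (z ≟ᶠ c x₁)) (recolour-at c v (c x₂)))
             (dec-false (c x₂ ≟ᶠ c x₁) (x₁≢x₂ ∘ sym ∘ colour-injective-on-K c-proper x₂∈K x₁∈K)))
      (λ y y≢v → cong (λ z → does (z ≟ᶠ c x₁))
                   (trans (recolour-off c (c x₁) y≢v) (sym (recolour-off c (c x₂) y≢v))))

  allOdd⇒oneNonNeighbourEach : (∀ B → IsClique G B → ∣ B ∣ ≤ ∣ K ∣) → AllClassesOdd →
    ∀ {c} → IsProperColoring G ∣ K ∣ c → OneNonNeighbourEach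
  allOdd⇒oneNonNeighbourEach K-maximum odd c-proper v v∉K
    with n≤1⇒n≡0∨n≡1 (≮⇒≥ (allOdd⇒nonNeighbours≱2 odd c-proper v∉K))
  ... | inj₁ #≡0 = ⊥-elim (nonNeighbours≢0 K-maximum v∉K #≡0)
  ... | inj₂ #≡1 = #≡1

proposition4 : {n : ℕ} (G : Graph n) (K : VSet n) (k s : ℕ) →
    IsMaximumClique G K → IsIndependent G (∁ K) →
    ∣ K ∣ ≡ k → IsChromaticNumber G k → ∣ ∁ K ∣ ≡ s →
    ((c : Fin n → Fin k) → IsProperColoring G k c → ∀ (i : Fin k) → Odd ∣ colorClass c i ∣)
    ⇔
    ((∀ v → K v ≡ false → degree G v ≡ k ∸ 1) ×
     (∀ x → K x ≡ true → degree G x % 2 ≢ (k + s) % 2))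
proposition4 G K _ _ (K-clique , K-maximum) S-independent refl ((c₀ , c₀-proper) , _) refl =
  mk⇔ to from
  where
  open SplitGraph G K K-clique S-independent
  degree⇔ : ∀ {v} → K v ≡ false → degree G v ≡ ∣ K ∣ ∸ 1 ⇔ nonNeighbours v ≡ 1
  degree⇔ v∉K = degree≡∣K∣∸1⇔nonNeighbours≡1 v∉K (nonNeighbours≢0 K-maximum v∉K)
  to : AllClassesOdd → DegreeConditions
  to odd = (λ v v∉K → Equivalence.from (degree⇔ v∉K) (one v v∉K))
         , (λ x x∈K → Equivalence.to (odd-class⇔parity c₀-proper one x∈K) (odd c₀ c₀-proper (c₀ x)))
    where
    one : OneNonNeighbourEach
    one = allOdd⇒oneNonNeighbourEach K-maximum odd c₀-proper
  from : DegreeConditions → AllClassesOdd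
  from (degrees , parities) c c-proper i with every-colour-meets-K c-proper i
  ... | x , x∈K , refl = Equivalence.from (odd-class⇔parity c-proper one x∈K) (parities x x∈K)
    where
    one : OneNonNeighbourEach
    one v v∉K = Equivalence.to (degree⇔ v∉K) (degrees v v∉K)
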